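{- $f^*(3,3)\leq \frac{11}{6}$.
   Context: For integers $n\geq 1$, $d\geq 1$, the triangular grid is $T_d(n):=\{(x_1,\dots,x_d)\in\mathbb{Z}_{\geq 0}^d : x_1+\dots+x_d\leq n-1\}$. A fractional cover of $T_d(n)$ is an assignment of nonnegative weights $w(H)$ to the affine hyperplanes $H$ of $\mathbb{R}^d$ (finitely many nonzero) such that $\sum_{H\ni p}w(H)\geq 1$ for every $p\in T_d(n)$; $f^*(n,d)$ is the minimum of $\sum_H w(H)$ over all fractional covers of $T_d(n)$. -}

module Defs where

open import Data.Nat using (ℕ; _<_)
open import Data.Integer as ℤ using (ℤ)
open import Data.Rational as ℚ using (ℚ)
open import Data.Vec using (Vec; zipWith; foldr; toList)
open import Data.List as List using (List; []; _∷_)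
open import Data.List.Relation.Unary.All using (All)
open import Data.Product using (_×_; _,_; proj₁; proj₂)
open import Relation.Nullary using (¬_; yes; no)
open import Relation.Binary.PropositionalEquality using (_≡_)

Point : ℕ → Set
Point d = Vec ℕ d

sumℕ : ∀ {d} → Vec ℕ d → ℕ
sumℕ = foldr _ Data.Nat._+_ 0

-- p ∈ T_d(n)  iff  x_1 + ... + x_d ≤ n - 1  iff  x_1 + ... + x_d < n
InT : (d n : ℕ) → Point d → Set
InT d n p = sumℕ p < n

record Hyperplane (d : ℕ) : Set where
  field
    coeff    : Vec ℤ d
    const    : ℤ
    nonzero  : ¬ All (_≡ ℤ.0ℤ) (toList coeff)

dot : ∀ {d} → Vec ℤ d → Point d → ℤ
dot a p = foldr _ ℤ._+_ ℤ.0ℤ (zipWith (λ ai xi → ai ℤ.* ℤ.+ xi) a p)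

weightAt : ∀ {d} → Point d → Hyperplane d × ℚ → ℚ
weightAt p (H , w) with dot (Hyperplane.coeff H) p ℤ.≟ Hyperplane.const H
... | yes _ = w
... | no  _ = ℚ.0ℚ

sumℚ : List ℚ → ℚ
sumℚ = List.foldr ℚ._+_ ℚ.0ℚ

-- A fractional cover of T_d(n): finitely many weighted hyperplanes
-- (a finite list; repeated hyperplanes have their weights added),
-- nonnegative weights, every point of T_d(n) covered with total weight ≥ 1.
record FractionalCover (d n : ℕ) : Set where
  field
    planes  : List (Hyperplane d × ℚ)
    nonneg  : All (λ Hw → ℚ.0ℚ ℚ.≤ proj₂ Hw) planes
    covers  : (p : Point d) → InT d n p →
              ℚ.1ℚ ℚ.≤ sumℚ (List.map (weightAt p) planes)

totalWeight : ∀ {d n} → FractionalCover d n → ℚ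
totalWeight c = sumℚ (List.map proj₂ (FractionalCover.planes c))

-- Weight 1/3 on the three coordinate planes and on x + y + z = 2, and weight
-- 1/6 on the three planes x_i + x_j = 1: total 4/3 + 1/2 = 11/6, and each of
-- the ten points of T_3(3) lies on planes of total weight exactly 1.
-- Since T_d(n) sits inside the box {0, …, n-1}^d, both conditions on a cover
-- are finitely many decidable facts, verified by evaluation.
module Submission where

open import Defs
open import Data.Product using (Σ; _×_; _,_; proj₂)
open import Data.Nat using (ℕ; zero; suc; _<?_)
open import Data.Nat.Properties using (m+n≤o⇒m≤o; m≤n+m; ≤-<-trans)
open import Data.Integer as ℤ using (ℤ; +_)
open import Data.Rational using (ℚ; 0ℚ; 1ℚ; _≤_; _≤?_; _/_)
open import Data.Vec using (Vec; []; _∷_; toList)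
open import Data.List using (List; []; _∷_; map; upTo; cartesianProductWith)
open import Data.List.Membership.Propositional using (_∈_)
open import Data.List.Membership.Propositional.Properties
  using (∈-cartesianProductWith⁺; ∈-upTo⁺)
open import Data.List.Relation.Unary.All as All using (all?)
open import Data.List.Relation.Unary.Any using (here)
open import Relation.Nullary.Decidable using (Dec; True; False; toWitness; toWitnessFalse; _→-dec_)
open import Relation.Binary.PropositionalEquality using (refl)

hyperplane : ∀ {d} (a : Vec ℤ d) (b : ℤ) → {False (all? (ℤ._≟ ℤ.0ℤ) (toList a))} →
             Hyperplane d
hyperplane a b {a≢0} = record { coeff = a ; const = b ; nonzero = toWitnessFalse a≢0 }

box : (d n : ℕ) → List (Point d)
box zero    n = [] ∷ []
box (suc d) n = cartesianProductWith _∷_ (upTo n) (box d n)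

InT⇒∈-box : ∀ {d n} (p : Point d) → InT d n p → p ∈ box d n
InT⇒∈-box []      _     = here refl
InT⇒∈-box (x ∷ p) x+s<n = ∈-cartesianProductWith⁺ _∷_
  (∈-upTo⁺ (m+n≤o⇒m≤o (suc x) x+s<n))
  (InT⇒∈-box p (≤-<-trans (m≤n+m (sumℕ p) x) x+s<n))

coverage : ∀ {d} → List (Hyperplane d × ℚ) → Point d → ℚ
coverage Hws p = sumℚ (map (weightAt p) Hws)

Covers : (d n : ℕ) → List (Hyperplane d × ℚ) → Point d → Set
Covers d n Hws p = InT d n p → 1ℚ ≤ coverage Hws p

covers? : ∀ d n Hws (p : Point d) → Dec (Covers d n Hws p)
covers? d n Hws p = (sumℕ p <? n) →-dec (1ℚ ≤? coverage Hws p)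

fractionalCover : ∀ {d n} (Hws : List (Hyperplane d × ℚ)) →
                  {True (all? (λ Hw → 0ℚ ≤? proj₂ Hw) Hws)} →
                  {True (all? (covers? d n Hws) (box d n))} →
                  FractionalCover d n
fractionalCover Hws {nonneg} {coversBox} = record
  { planes = Hws
  ; nonneg = toWitness nonneg
  ; covers = λ p p∈T → All.lookup (toWitness coversBox) (InT⇒∈-box p p∈T) p∈T
  }

cover : FractionalCover 3 3
cover = fractionalCover
  ( (hyperplane (+ 1 ∷ + 0 ∷ + 0 ∷ []) (+ 0) , + 1 / 3)
  ∷ (hyperplane (+ 0 ∷ + 1 ∷ + 0 ∷ []) (+ 0) , + 1 / 3)
  ∷ (hyperplane (+ 0 ∷ + 0 ∷ + 1 ∷ []) (+ 0) , + 1 / 3)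
  ∷ (hyperplane (+ 1 ∷ + 1 ∷ + 1 ∷ []) (+ 2) , + 1 / 3)
  ∷ (hyperplane (+ 0 ∷ + 1 ∷ + 1 ∷ []) (+ 1) , + 1 / 6)
  ∷ (hyperplane (+ 1 ∷ + 0 ∷ + 1 ∷ []) (+ 1) , + 1 / 6)
  ∷ (hyperplane (+ 1 ∷ + 1 ∷ + 0 ∷ []) (+ 1) , + 1 / 6)
  ∷ [])

proposition3p4 : Σ (FractionalCover 3 3) (λ c → totalWeight c ≤ (+ 11) / 6)
proposition3p4 = cover , toWitness {a? = totalWeight cover ≤? (+ 11) / 6} _
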